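{- Let $\chi$ be a sentence of dependence logic over a vocabulary $\tau\cup\{Y\}$, where $Y$ is a unary relation symbol not in $\tau$, and suppose the variables $y,v,u,u'$ (pairwise distinct) do not occur in $\chi$. Let $\mathfrak{A}$ be a $\tau$-model with $|A|\geq 2$, let $S\subseteq A$ be nonempty, let $a,b\in A$ with $a\neq b$, and let $V$ be the team $V=\{\,s:\{y,u,u'\}\to A\ \mid\ s(y)\in S,\ s(u)=a,\ s(u')=b\,\}$. Then $(\mathfrak{A},Y\mapsto S),\{\emptyset\}\models\chi$ if and only if $\mathfrak{A},V\models T_Y^y(\chi)$.
   Context: Lax team semantics. An assignment is a function $s:X\to A$ with $X$ a finite set of variables; $s[a/x]$ maps $x$ to $a$ and agrees with $s$ elsewhere. A team with codomain $A$ is a set $U$ of assignments $X\to A$ with a common domain $X=\mathit{Dom}(U)$ ($\emptyset$ and $\{\emptyset\}$ are teams). For a set $T$, $U[T/x]=\{s[c/x]: c\in T, s\in U\}$, and for $f:U\to\mathcal{P}(T)$, $U[f/x]=\bigcup_{s\in U}\{s[c/x]:c\in f(s)\}$. For variables $\overline{x}=(x_1,\dots,x_k)$, $\mathit{Rel}(U,\overline{x})=\{(s(x_1),\dots,s(x_k)):s\in U\}$. Formulas are in negation normal form (negations only in front of first-order atoms $R(\overline{x})$, $x=z$). Semantics: for a first-order literal $\alpha$, $\mathfrak{A},U\models\alpha$ iff every $s\in U$ satisfies $\alpha$ in the Tarskian sense; $\mathfrak{A},U\models\varphi\wedge\psi$ iff both hold; $\mathfrak{A},U\models\varphi\vee\psi$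 iff $\mathfrak{A},U_0\models\varphi$ and $\mathfrak{A},U_1\models\psi$ for some $U_0,U_1\subseteq U$ with $U_0\cup U_1=U$; $\mathfrak{A},U\models\forall x\,\varphi$ iff $\mathfrak{A},U[A/x]\models\varphi$; $\mathfrak{A},U\models\exists x\,\varphi$ iff $\mathfrak{A},U[f/x]\models\varphi$ for some $f:U\to\mathcal{P}(A)\setminus\{\emptyset\}$. A sentence is true iff it holds for the team $\{\emptyset\}$. Atoms: dependence atom $=\!(x_1,\dots,x_k)$ holds in $U$ iff any $s,t\in U$ agreeing on $x_1,\dots,x_{k-1}$ agree on $x_k$; inclusion atom $\overline{x}\subseteq\overline{z}$ holds iff $\mathit{Rel}(U,\overline{x})\subseteq\mathit{Rel}(U,\overline{z})$; exclusion atom $\overline{x}\,|\,\overline{z}$ holds iff $\mathit{Rel}(U,\overline{x})\cap\mathit{Rel}(U,\overline{z})=\emptyset$; conditional independence atom $\overline{x}\perp_{\overline{z}}\overline{w}$ holds iff for all $s,s'\in U$ with $s(\overline{z})=s'(\overline{z})$ there is $t\in U$ with $t(\overline{x})=s(\overline{x})$, $t(\overline{z})=s(\overline{z})$, $t(\overline{w})=s'(\overline{w})$; when $\overline{z}$ is empty this is the unconditional atom $\overline{x}\perp\overline{w}$ (for all $s,s'\in U$ there is $t\in U$ with $t(\overline{x})=s(\overline{x})$, $t(\overline{w})=s'(\overline{w})$). Dependence logic is first-order logic in negation normal form extended with dependence atoms. $(\mathfrak{A},Y\mapsto S)$ is the expansion of $\mathfrak{A}$ interpreting $Y$ as $S$.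 The translation $T_Y^y$ (with auxiliary variables $y,v,u,u'$ not occurring in the sentence $\chi$ being translated) is defined recursively on subformulas of $\chi$: $T_Y^y$ is the identity on $R(\overline{x})$, $\neg R(\overline{x})$ for $R\neq Y$, on $x=z$, $\neg x=z$, and on dependence atoms; $T_Y^y(Y(x))=x\subseteq y$ and $T_Y^y(\neg Y(x))=x\,|\,y$; $T_Y^y(\varphi\wedge\psi)=T_Y^y(\varphi)\wedge T_Y^y(\psi)$; $T_Y^y(\varphi\vee\psi)=\exists v\bigl(v\perp_{\overline{z}}y\wedge((T_Y^y(\varphi)\wedge v=u)\vee(T_Y^y(\psi)\wedge v=u'))\bigr)$, where $\overline{z}$ lists exactly the variables quantified superordinate to this occurrence of $\varphi\vee\psi$ in $\chi$ (i.e., the $x$ such that it lies in the scope of $\exists x$ or $\forall x$); if $\exists x\,\varphi$ lies within some disjunction subformula $\alpha\vee\beta$ of $\chi$, then $T_Y^y(\exists x\,\varphi)=\exists x\bigl(x\perp_{\overline{z}}yv\wedge T_Y^y(\varphi)\bigr)$, and otherwise $T_Y^y(\exists x\,\varphi)=\exists x\bigl(x\perp_{\overline{z}}y\wedge T_Y^y(\varphi)\bigr)$, where in both cases $\overline{z}$ lists the variables quantified superordinate to this occurrence of $\exists x\,\varphi$ in $\chi$, excluding $x$ itself; $T_Y^y(\forall x\,\varphi)=\forall x\,T_Y^y(\varphi)$. -}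

module Defs where

open import Level using (Level; Lift; 0ℓ; lift) renaming (suc to lsuc)
open import Data.Nat using (ℕ; zero; suc)
open import Data.Nat.Properties using (_≟_)
open import Data.Bool using (Bool; true; false; if_then_else_)
open import Data.Maybe using (Maybe; just; nothing; maybe)
open import Data.List using (List; []; _∷_; filter)
import Data.List as L
open import Data.Vec using (Vec; []; _∷_; head)
import Data.Vec as V
open import Data.Product using (Σ; ∃; _×_; _,_)
open import Data.Sum using (_⊎_)
open import Data.Empty using (⊥)
open import Data.Unit using (⊤)
open import Relation.Nullary using (¬_; ¬?; does)
open import Relation.Binary.PropositionalEquality using (_≡_; _≢_)

Var : Set
Var = ℕ

record Vocab : Set₁ where
  field
    Sym : Set
    ar  : Sym → ℕ
open Vocab public

-- τ ∪ {Y}: the extra symbol Y (= nothing) is unary.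
VY : Vocab → Vocab
VY τ = record { Sym = Maybe (Sym τ) ; ar = maybe (ar τ) 1 }

data Fm (τ : Vocab) : Set where
  rel nrel : (R : Sym τ) → Vec Var (ar τ R) → Fm τ
  eq neq   : Var → Var → Fm τ
  dep      : List Var → Var → Fm τ
  inc exc  : {k : ℕ} → Vec Var k → Vec Var k → Fm τ
  ind      : List Var → List Var → List Var → Fm τ      -- ind x̄ z̄ w̄  =  x̄ ⊥_z̄ w̄
  and or   : Fm τ → Fm τ → Fm τ
  ex all   : Var → Fm τ → Fm τ

IsDL : {τ : Vocab} → Fm τ → Set
IsDL (inc _ _)   = ⊥
IsDL (exc _ _)   = ⊥
IsDL (ind _ _ _) = ⊥
IsDL (and φ ψ)   = IsDL φ × IsDL ψ
IsDL (or φ ψ)    = IsDL φ × IsDL ψ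
IsDL (ex _ φ)    = IsDL φ
IsDL (all _ φ)   = IsDL φ
IsDL _           = ⊤

InL : Var → List Var → Set
InL x [] = ⊥
InL x (z ∷ zs) = x ≡ z ⊎ InL x zs

AllInL : List Var → List Var → Set
AllInL [] ctx = ⊤
AllInL (x ∷ xs) ctx = InL x ctx × AllInL xs ctx

AllInV : {k : ℕ} → Vec Var k → List Var → Set
AllInV xs ctx = AllInL (V.toList xs) ctx

BoundIn : {τ : Vocab} → List Var → Fm τ → Set
BoundIn ctx (rel R xs)  = AllInV xs ctx
BoundIn ctx (nrel R xs) = AllInV xs ctx
BoundIn ctx (eq x z)    = InL x ctx × InL z ctx
BoundIn ctx (neq x z)   = InL x ctx × InL z ctx
BoundIn ctx (dep xs x)  = AllInL xs ctx × InL x ctx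
BoundIn ctx (inc xs zs) = AllInV xs ctx × AllInV zs ctx
BoundIn ctx (exc xs zs) = AllInV xs ctx × AllInV zs ctx
BoundIn ctx (ind xs zs ws) = AllInL xs ctx × AllInL zs ctx × AllInL ws ctx
BoundIn ctx (and φ ψ)   = BoundIn ctx φ × BoundIn ctx ψ
BoundIn ctx (or φ ψ)    = BoundIn ctx φ × BoundIn ctx ψ
BoundIn ctx (ex x φ)    = BoundIn (x ∷ ctx) φ
BoundIn ctx (all x φ)   = BoundIn (x ∷ ctx) φ

Sentence : {τ : Vocab} → Fm τ → Set
Sentence φ = BoundIn [] φ

NotOccL : Var → List Var → Set
NotOccL y xs = ¬ InL y xs

NotOcc : {τ : Vocab} → Var → Fm τ → Set
NotOcc y (rel R xs)  = NotOccL y (V.toList xs)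
NotOcc y (nrel R xs) = NotOccL y (V.toList xs)
NotOcc y (eq x z)    = y ≢ x × y ≢ z
NotOcc y (neq x z)   = y ≢ x × y ≢ z
NotOcc y (dep xs x)  = NotOccL y xs × y ≢ x
NotOcc y (inc xs zs) = NotOccL y (V.toList xs) × NotOccL y (V.toList zs)
NotOcc y (exc xs zs) = NotOccL y (V.toList xs) × NotOccL y (V.toList zs)
NotOcc y (ind xs zs ws) = NotOccL y xs × NotOccL y zs × NotOccL y ws
NotOcc y (and φ ψ)   = NotOcc y φ × NotOcc y ψ
NotOcc y (or φ ψ)    = NotOcc y φ × NotOcc y ψ
NotOcc y (ex x φ)    = y ≢ x × NotOcc y φ
NotOcc y (all x φ)   = y ≢ x × NotOcc y φ

-- Arguments: y v u u', the list ctx of the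
-- variables quantified superordinate to the current subformula (in χ),
-- and a flag telling whether we are inside a disjunction of χ.

remove : Var → List Var → List Var
remove x = filter (λ z → ¬? (z ≟ x))

T : {τ : Vocab} → (y v u u' : Var) → List Var → Bool → Fm (VY τ) → Fm τ
T y v u u' ctx d (rel (just R) xs)  = rel R xs
T y v u u' ctx d (rel nothing xs)   = inc xs (y ∷ [])
T y v u u' ctx d (nrel (just R) xs) = nrel R xs
T y v u u' ctx d (nrel nothing xs)  = exc xs (y ∷ [])
T y v u u' ctx d (eq x z)    = eq x z
T y v u u' ctx d (neq x z)   = neq x z
T y v u u' ctx d (dep xs x)  = dep xs x
T y v u u' ctx d (inc xs zs) = inc xs zs
T y v u u' ctx d (exc xs zs) = exc xs zs
T y v u u' ctx d (ind xs zs ws) = ind xs zs ws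
T y v u u' ctx d (and φ ψ)   = and (T y v u u' ctx d φ) (T y v u u' ctx d ψ)
T y v u u' ctx d (or φ ψ)    =
  ex v (and (ind (v ∷ []) ctx (y ∷ []))
            (or (and (T y v u u' ctx true φ) (eq v u))
                (and (T y v u u' ctx true ψ) (eq v u'))))
T y v u u' ctx true  (ex x φ) =
  ex x (and (ind (x ∷ []) (remove x ctx) (y ∷ v ∷ [])) (T y v u u' (x ∷ ctx) true φ))
T y v u u' ctx false (ex x φ) =
  ex x (and (ind (x ∷ []) (remove x ctx) (y ∷ [])) (T y v u u' (x ∷ ctx) false φ))
T y v u u' ctx d (all x φ)   = all x (T y v u u' (x ∷ ctx) d φ)

TY : {τ : Vocab} → (y v u u' : Var) → Fm (VY τ) → Fm τ
TY y v u u' χ = T y v u u' [] false χ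

record Structure (τ : Vocab) (A : Set) : Set₁ where
  field
    interp : (R : Sym τ) → Vec A (ar τ R) → Set
open Structure public

expand : {τ : Vocab} {A : Set} → Structure τ A → (A → Set) → Structure (VY τ) A
interp (expand M S) (just R) as = interp M R as
interp (expand M S) nothing as  = S (head as)

-- An assignment is a partial map Var ⇀ A; its domain is the set of
-- variables mapped to 'just'.
Asg : Set → Set
Asg A = Var → Maybe A

upd : {A : Set} → Asg A → Var → A → Asg A
upd s x c z = if does (z ≟ x) then just c else s z

_≗ₐ_ : {A : Set} → Asg A → Asg A → Set
s ≗ₐ t = ∀ z → s z ≡ t z

-- A team is a set (predicate) of assignments, considered up to ≗ₐ.
Team : Set → Set₁
Team A = Asg A → Set

emptyAsg : {A : Set} → Asg A
emptyAsg _ = nothing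

unitTeam : {A : Set} → Team A
unitTeam s = s ≗ₐ emptyAsg

-- U[F/x] for F : U → 𝒫(A), given as a relation
updF : {A : Set} → Team A → Var → (Asg A → A → Set) → Team A
updF U x F t = Σ _ λ s → U s × Σ _ λ c → F s c × (t ≗ₐ upd s x c)

updAll : {A : Set} → Team A → Var → Team A
updAll U x = updF U x (λ _ _ → ⊤)

allJust : {A : Set} {k : ℕ} → Vec (Maybe A) k → Maybe (Vec A k)
allJust [] = just []
allJust (nothing ∷ ms) = nothing
allJust (just a ∷ ms) with allJust ms
... | nothing = nothing
... | just as = just (a ∷ as)

RelHolds : {τ : Vocab} {A : Set} → Structure τ A → (R : Sym τ) → Vec Var (ar τ R) → Asg A → Set
RelHolds M R xs s = Σ _ λ as → allJust (V.map s xs) ≡ just as × interp M R as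

NRelHolds : {τ : Vocab} {A : Set} → Structure τ A → (R : Sym τ) → Vec Var (ar τ R) → Asg A → Set
NRelHolds M R xs s = Σ _ λ as → allJust (V.map s xs) ≡ just as × ¬ interp M R as

EqHolds : {A : Set} → Var → Var → Asg A → Set
EqHolds x z s = Σ _ λ a → s x ≡ just a × s z ≡ just a

NEqHolds : {A : Set} → Var → Var → Asg A → Set
NEqHolds x z s = Σ _ λ a → Σ _ λ b → s x ≡ just a × s z ≡ just b × a ≢ b

-- Lax team semantics
⟦_,_⊨_⟧ : {τ : Vocab} {A : Set} → Structure τ A → Team A → Fm τ → Set₁
⟦ M , U ⊨ rel R xs ⟧  = Lift (lsuc 0ℓ) (∀ s → U s → RelHolds M R xs s)
⟦ M , U ⊨ nrel R xs ⟧ = Lift (lsuc 0ℓ) (∀ s → U s → NRelHolds M R xs s)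
⟦ M , U ⊨ eq x z ⟧    = Lift (lsuc 0ℓ) (∀ s → U s → EqHolds x z s)
⟦ M , U ⊨ neq x z ⟧   = Lift (lsuc 0ℓ) (∀ s → U s → NEqHolds x z s)
⟦ M , U ⊨ dep xs x ⟧  = Lift (lsuc 0ℓ)
  (∀ s t → U s → U t → L.map s xs ≡ L.map t xs → s x ≡ t x)
⟦ M , U ⊨ inc xs zs ⟧ = Lift (lsuc 0ℓ)
  (∀ s → U s → Σ _ λ t → U t × V.map s xs ≡ V.map t zs)
⟦ M , U ⊨ exc xs zs ⟧ = Lift (lsuc 0ℓ)
  (∀ s t → U s → U t → V.map s xs ≢ V.map t zs)
⟦ M , U ⊨ ind xs zs ws ⟧ = Lift (lsuc 0ℓ)
  (∀ s s' → U s → U s' → L.map s zs ≡ L.map s' zs →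
     Σ _ λ t → U t × L.map t xs ≡ L.map s xs × L.map t zs ≡ L.map s zs
                   × L.map t ws ≡ L.map s' ws)
⟦ M , U ⊨ and φ ψ ⟧ = ⟦ M , U ⊨ φ ⟧ × ⟦ M , U ⊨ ψ ⟧
⟦ M , U ⊨ or φ ψ ⟧  =
  Σ (Team _) λ U₀ → Σ (Team _) λ U₁ →
    (∀ s → U₀ s → U s) × (∀ s → U₁ s → U s) × (∀ s → U s → U₀ s ⊎ U₁ s)
    × ⟦ M , U₀ ⊨ φ ⟧ × ⟦ M , U₁ ⊨ ψ ⟧
⟦ M , U ⊨ all x φ ⟧ = ⟦ M , updAll U x ⊨ φ ⟧
⟦ M , U ⊨ ex x φ ⟧  =
  Σ (Asg _ → _ → Set) λ F → (∀ s → U s → Σ _ λ c → F s c) × ⟦ M , updF U x F ⊨ φ ⟧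

VTeam : {A : Set} → (A → Set) → A → A → (y u u' : Var) → Team A
VTeam S a b y u u' s =
  (Σ _ λ c → S c × s y ≡ just c) × s u ≡ just a × s u' ≡ just b
  × (∀ z → z ≢ y → z ≢ u → z ≢ u' → s z ≡ nothing)

-- Evaluating a subformula of χ on a team W of (𝔄, Y ↦ S) corresponds to evaluating its
-- translation in 𝔄 on the team Ext m W, in which every assignment of W is combined with every
-- value of y in S, while u = a, u' = b and v is fixed. Under this correspondence Y(x) becomes
-- x ⊆ y and ¬Y(x) becomes x | y, and the claim follows by induction on χ. A disjunction is
-- simulated by choosing v ∈ {a, b} to mark the two halves of the team. Conversely, the
-- independence atoms guarantee that the teams produced by ∃ on the translated side still let y
-- range over all of S independently of everything else, so that they are again of the form
-- Ext m W and the induction hypothesis applies.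
module Submission where

open import Defs
open import Level using (Lift; lift; 0ℓ) renaming (suc to lsuc)
open import Data.Bool using (Bool; true; false; if_then_else_)
open import Data.Empty using (⊥-elim)
open import Data.Unit using (tt)
open import Data.Maybe using (Maybe; just; nothing)
open import Data.Maybe.Properties using (just-injective)
open import Data.Nat using (ℕ)
open import Data.Nat.Properties using (_≟_)
open import Data.List using (List; []; _∷_)
import Data.List as L
open import Data.List.Properties using (∷-injective)
open import Data.List.Membership.Propositional using (_∈_)
open import Data.List.Membership.Propositional.Properties using (∈-filter⁺; ∈-filter⁻)
open import Data.List.Relation.Unary.Any using (here; there)
open import Data.Vec using (Vec; []; _∷_)
import Data.Vec as V
open import Data.Vec.Properties using (∷-injectiveˡ)
open import Data.Product using (Σ; _×_; _,_; proj₁; proj₂)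
open import Data.Product.Function.NonDependent.Propositional using (_×-⇔_)
open import Data.Sum using (_⊎_; inj₁; inj₂; [_,_]′) renaming (map to ⊎-map; swap to ⊎-swap)
open import Function.Base using (_∘_)
open import Function.Bundles using (_⇔_; mk⇔; Equivalence)
open import Function.Properties.Equivalence using () renaming (trans to ⇔-trans)
open import Relation.Nullary using (¬_; Dec; yes; no; does; ¬?)
open import Relation.Nullary.Decidable using (dec-true; dec-false; _⊎-dec_)
open import Relation.Binary.PropositionalEquality
open ≡-Reasoning

upd-same : {A : Set} (s : Asg A) (x : Var) (c : A) → upd s x c x ≡ just c
upd-same s x c rewrite dec-true (x ≟ x) refl = refl

upd-other : {A : Set} (s : Asg A) (x : Var) (c : A) {z : Var} → z ≢ x → upd s x c z ≡ s z
upd-other s x c {z} z≢x rewrite dec-false (z ≟ x) z≢x = refl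

upd-cong : {A : Set} {s s' : Asg A} (x : Var) (c : A) → s ≗ₐ s' → upd s x c ≗ₐ upd s' x c
upd-cong x c s≗s' z = cong (λ r → if does (z ≟ x) then just c else r) (s≗s' z)

InL? : (z : Var) (zs : List Var) → Dec (InL z zs)
InL? z [] = no (λ ())
InL? z (x ∷ zs) = (z ≟ x) ⊎-dec InL? z zs

InL⇒∈ : {z : Var} {zs : List Var} → InL z zs → z ∈ zs
InL⇒∈ {zs = _ ∷ _} (inj₁ z≡x) = here z≡x
InL⇒∈ {zs = _ ∷ _} (inj₂ i) = there (InL⇒∈ i)

∈⇒InL : {z : Var} {zs : List Var} → z ∈ zs → InL z zs
∈⇒InL (here z≡x) = inj₁ z≡x
∈⇒InL (there i) = inj₂ (∈⇒InL i)

InL-remove⁺ : {z x : Var} {zs : List Var} → InL z zs → z ≢ x → InL z (remove x zs)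
InL-remove⁺ {x = x} i z≢x = ∈⇒InL (∈-filter⁺ (λ z → ¬? (z ≟ x)) (InL⇒∈ i) z≢x)

InL-remove⁻ : {z x : Var} {zs : List Var} → InL z (remove x zs) → InL z zs × z ≢ x
InL-remove⁻ {x = x} i with ∈-filter⁻ (λ z → ¬? (z ≟ x)) (InL⇒∈ i)
... | z∈zs , z≢x = ∈⇒InL z∈zs , z≢x

InL-∷-remove : {z x : Var} {zs : List Var} → InL z (x ∷ zs) → z ≡ x ⊎ InL z (remove x zs)
InL-∷-remove (inj₁ z≡x) = inj₁ z≡x
InL-∷-remove {z} {x} (inj₂ z∈zs) with z ≟ x
... | yes z≡x = inj₁ z≡x
... | no z≢x = inj₂ (InL-remove⁺ z∈zs z≢x)

InL-∉⇒≢ : {z q : Var} {zs : List Var} → InL z zs → ¬ InL q zs → q ≢ z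
InL-∉⇒≢ i q∉ refl = q∉ i

map-cong-InL : {B : Set} {f g : Var → B} (zs : List Var) →
  (∀ {z} → InL z zs → f z ≡ g z) → L.map f zs ≡ L.map g zs
map-cong-InL [] f≡g = refl
map-cong-InL (x ∷ zs) f≡g = cong₂ _∷_ (f≡g (inj₁ refl)) (map-cong-InL zs (f≡g ∘ inj₂))

vmap-cong-InL : {B : Set} {f g : Var → B} {k : ℕ} (zs : Vec Var k) →
  (∀ {z} → InL z (V.toList zs) → f z ≡ g z) → V.map f zs ≡ V.map g zs
vmap-cong-InL [] f≡g = refl
vmap-cong-InL (x ∷ zs) f≡g = cong₂ _∷_ (f≡g (inj₁ refl)) (vmap-cong-InL zs (f≡g ∘ inj₂))

map-≡⇒InL : {B : Set} {f g : Var → B} (zs : List Var) →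
  L.map f zs ≡ L.map g zs → ∀ {z} → InL z zs → f z ≡ g z
map-≡⇒InL (x ∷ zs) fs≡gs (inj₁ refl) = proj₁ (∷-injective fs≡gs)
map-≡⇒InL (x ∷ zs) fs≡gs (inj₂ i) = map-≡⇒InL zs (proj₂ (∷-injective fs≡gs)) i

allJust-single : {A : Set} {mx : Maybe A} {as : Vec A 1} → allJust (mx ∷ []) ≡ just as → mx ≡ just (V.head as)
allJust-single {mx = just k} refl = refl

allJust-single⁺ : {A : Set} {mx : Maybe A} {k : A} → mx ≡ just k → allJust (mx ∷ []) ≡ just (k ∷ [])
allJust-single⁺ refl = refl

_⊆ᵀ_ : {A : Set} → Team A → Team A → Set
U ⊆ᵀ U' = ∀ t → U t → U' t

updF-mono : {A : Set} {U U' : Team A} (x : Var) (F : Asg A → A → Set) →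
  U ⊆ᵀ U' → updF U x F ⊆ᵀ updF U' x F
updF-mono x F U⊆U' t (s , Us , c , Fsc , t≗) = s , U⊆U' s Us , c , Fsc , t≗

updF-resp-≗ₐ : {A : Set} {U : Team A} {x : Var} {F : Asg A → A → Set} {t t' : Asg A} →
  t' ≗ₐ t → updF U x F t → updF U x F t'
updF-resp-≗ₐ t'≗t (s , Us , c , Fsc , t≗) = s , Us , c , Fsc , λ z → trans (t'≗t z) (t≗ z)

upd∈updF : {A : Set} {U : Team A} {x : Var} {F : Asg A → A → Set} {s : Asg A} {c : A} →
  U s → F s c → updF U x F (upd s x c)
upd∈updF {s = s} Us Fsc = s , Us , _ , Fsc , λ _ → refl

⊨-resp : {τ : Vocab} {A : Set} (M : Structure τ A) (φ : Fm τ) {U U' : Team A} →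
  U ⊆ᵀ U' → U' ⊆ᵀ U → ⟦ M , U ⊨ φ ⟧ → ⟦ M , U' ⊨ φ ⟧
⊨-resp M (rel R xs) ⊆ ⊇ (lift h) = lift λ s Us → h s (⊇ s Us)
⊨-resp M (nrel R xs) ⊆ ⊇ (lift h) = lift λ s Us → h s (⊇ s Us)
⊨-resp M (eq x z) ⊆ ⊇ (lift h) = lift λ s Us → h s (⊇ s Us)
⊨-resp M (neq x z) ⊆ ⊇ (lift h) = lift λ s Us → h s (⊇ s Us)
⊨-resp M (dep xs x) ⊆ ⊇ (lift h) = lift λ s t Us Ut → h s t (⊇ s Us) (⊇ t Ut)
⊨-resp M (inc xs zs) ⊆ ⊇ (lift h) = lift λ s Us → let (t , Ut , e) = h s (⊇ s Us) in t , ⊆ t Ut , e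
⊨-resp M (exc xs zs) ⊆ ⊇ (lift h) = lift λ s t Us Ut → h s t (⊇ s Us) (⊇ t Ut)
⊨-resp M (ind xs zs ws) ⊆ ⊇ (lift h) = lift λ s s' Us Us' e →
  let (t , Ut , r) = h s s' (⊇ s Us) (⊇ s' Us') e in t , ⊆ t Ut , r
⊨-resp M (and φ ψ) ⊆ ⊇ (p , q) = ⊨-resp M φ ⊆ ⊇ p , ⊨-resp M ψ ⊆ ⊇ q
⊨-resp M (or φ ψ) ⊆ ⊇ (U₀ , U₁ , U₀⊆ , U₁⊆ , cover , h₀ , h₁) =
  U₀ , U₁ , (λ s → ⊆ s ∘ U₀⊆ s) , (λ s → ⊆ s ∘ U₁⊆ s) , (λ s → cover s ∘ ⊇ s) , h₀ , h₁
⊨-resp M (ex x φ) ⊆ ⊇ (F , total , h) =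
  F , (λ s → total s ∘ ⊇ s) , ⊨-resp M φ (updF-mono x F ⊆) (updF-mono x F ⊇) h
⊨-resp M (all x φ) ⊆ ⊇ h = ⊨-resp M φ (updF-mono x _ ⊆) (updF-mono x _ ⊇) h

⊨-cong : {τ : Vocab} {A : Set} (M : Structure τ A) (φ : Fm τ) {U U' : Team A} →
  U ⊆ᵀ U' → U' ⊆ᵀ U → ⟦ M , U ⊨ φ ⟧ ⇔ ⟦ M , U' ⊨ φ ⟧
⊨-cong M φ ⊆ ⊇ = mk⇔ (⊨-resp M φ ⊆ ⊇) (⊨-resp M φ ⊇ ⊆)

record HasDomain {A : Set} (D : List Var) (w : Asg A) : Set where
  field
    defined   : ∀ {z} → InL z D → Σ A λ e → w z ≡ just e
    undefined : ∀ {z} → ¬ InL z D → w z ≡ nothing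
open HasDomain

TeamDom : {A : Set} → List Var → Team A → Set
TeamDom D W = ∀ {w} → W w → HasDomain D w

HasDomain-upd : {A : Set} {D : List Var} {w : Asg A} (x : Var) (e : A) →
  HasDomain D w → HasDomain (x ∷ D) (upd w x e)
HasDomain-upd {D = D} {w} x e dom = record { defined = defined-upd ; undefined = undefined-upd }
  where
  defined-upd : ∀ {z} → InL z (x ∷ D) → Σ _ λ e' → upd w x e z ≡ just e'
  defined-upd (inj₁ refl) = e , upd-same w x e
  defined-upd {z} (inj₂ z∈D) with z ≟ x
  ... | yes refl = e , upd-same w x e
  ... | no z≢x = let (e' , wz) = defined dom z∈D in e' , trans (upd-other w x e z≢x) wz
  undefined-upd : ∀ {z} → ¬ InL z (x ∷ D) → upd w x e z ≡ nothing
  undefined-upd z∉ = trans (upd-other w x e (z∉ ∘ inj₁)) (undefined dom (z∉ ∘ inj₂))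

HasDomain-resp-≗ₐ : {A : Set} {D : List Var} {w w' : Asg A} → w' ≗ₐ w → HasDomain D w → HasDomain D w'
HasDomain-resp-≗ₐ w'≗w dom = record
  { defined = λ {z} i → let (e , wz) = defined dom i in e , trans (w'≗w z) wz
  ; undefined = λ {z} i → trans (w'≗w z) (undefined dom i) }

updF-TeamDom : {A : Set} {D : List Var} {W : Team A} {x : Var} {F : Asg A → A → Set} →
  TeamDom D W → TeamDom (x ∷ D) (updF W x F)
updF-TeamDom {x = x} dom (w , Ww , e , _ , w'≗) = HasDomain-resp-≗ₐ w'≗ (HasDomain-upd x e (dom Ww))

module Translation {τ : Vocab} {A : Set} (𝔄 : Structure τ A) (S : A → Set) {c₀ : A} (Sc₀ : S c₀)
  (a b : A) (a≢b : a ≢ b) (y v u u' : Var)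
  (y≢v : y ≢ v) (y≢u : y ≢ u) (y≢u' : y ≢ u') (v≢u : v ≢ u) (v≢u' : v ≢ u') (u≢u' : u ≢ u') where

  E : Structure (VY τ) A
  E = expand 𝔄 S

  record Fresh (z : Var) : Set where
    constructor fresh
    field
      y≢ : y ≢ z
      v≢ : v ≢ z
      u≢ : u ≢ z
      u'≢ : u' ≢ z
  open Fresh

  FreshList : List Var → Set
  FreshList zs = ∀ {z} → InL z zs → Fresh z

  freshList : {zs : List Var} → NotOccL y zs → NotOccL v zs → NotOccL u zs → NotOccL u' zs → FreshList zs
  freshList y∉ v∉ u∉ u'∉ i =
    fresh (InL-∉⇒≢ i y∉) (InL-∉⇒≢ i v∉) (InL-∉⇒≢ i u∉) (InL-∉⇒≢ i u'∉)

  FreshList-∷ : {x : Var} {zs : List Var} → Fresh x → FreshList zs → FreshList (x ∷ zs)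
  FreshList-∷ fx fzs (inj₁ refl) = fx
  FreshList-∷ fx fzs (inj₂ i) = fzs i

  _≈ᶠ_ : Asg A → Asg A → Set
  s ≈ᶠ t = ∀ {z} → Fresh z → s z ≡ t z

  map-≈ᶠ : {zs : List Var} {s t : Asg A} → FreshList zs → s ≈ᶠ t → L.map s zs ≡ L.map t zs
  map-≈ᶠ {zs} fzs s≈t = map-cong-InL zs (s≈t ∘ fzs)

  vmap-≈ᶠ : {k : ℕ} {zs : Vec Var k} {s t : Asg A} →
    FreshList (V.toList zs) → s ≈ᶠ t → V.map s zs ≡ V.map t zs
  vmap-≈ᶠ {zs = zs} fzs s≈t = vmap-cong-InL zs (s≈t ∘ fzs)

  -- Opaque, so that unification can read m, w and c off a term extend m w c.
  opaque
    extend : Maybe A → Asg A → A → Asg A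
    extend m w c z =
      if does (z ≟ y) then just c else
      if does (z ≟ u) then just a else
      if does (z ≟ u') then just b else
      if does (z ≟ v) then m else w z

  module _ {m : Maybe A} {w : Asg A} {c : A} where
    opaque
      unfolding extend

      extend-y : extend m w c y ≡ just c
      extend-y rewrite dec-true (y ≟ y) refl = refl

      extend-u : extend m w c u ≡ just a
      extend-u rewrite dec-false (u ≟ y) (≢-sym y≢u) | dec-true (u ≟ u) refl = refl

      extend-u' : extend m w c u' ≡ just b
      extend-u' rewrite dec-false (u' ≟ y) (≢-sym y≢u') | dec-false (u' ≟ u) (≢-sym u≢u')
                      | dec-true (u' ≟ u') refl = refl

      extend-v : extend m w c v ≡ m
      extend-v rewrite dec-false (v ≟ y) (≢-sym y≢v) | dec-false (v ≟ u) v≢u | dec-false (v ≟ u') v≢u'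
                     | dec-true (v ≟ v) refl = refl

      extend-fresh : extend m w c ≈ᶠ w
      extend-fresh {z} fz rewrite dec-false (z ≟ y) (≢-sym (y≢ fz)) | dec-false (z ≟ u) (≢-sym (u≢ fz))
                                | dec-false (z ≟ u') (≢-sym (u'≢ fz)) | dec-false (z ≟ v) (≢-sym (v≢ fz)) = refl

      extend-≢y : {c' : A} {z : Var} → y ≢ z → extend m w c z ≡ extend m w c' z
      extend-≢y {z = z} y≢z rewrite dec-false (z ≟ y) (≢-sym y≢z) = refl

  ≗-extend : {m : Maybe A} {w : Asg A} {c : A} {t : Asg A} →
    t y ≡ just c → t u ≡ just a → t u' ≡ just b → t v ≡ m → t ≈ᶠ w → t ≗ₐ extend m w c
  ≗-extend ty tu tu' tv t≈w z with z ≟ y | z ≟ u | z ≟ u' | z ≟ v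
  ... | yes refl | _ | _ | _ = trans ty (sym extend-y)
  ... | no _ | yes refl | _ | _ = trans tu (sym extend-u)
  ... | no _ | no _ | yes refl | _ = trans tu' (sym extend-u')
  ... | no _ | no _ | no _ | yes refl = trans tv (sym extend-v)
  ... | no z≢y | no z≢u | no z≢u' | no z≢v = trans (t≈w fz) (sym (extend-fresh fz))
    where fz = fresh (≢-sym z≢y) (≢-sym z≢v) (≢-sym z≢u) (≢-sym z≢u')

  ≗extend⇒≈ᶠ : {m : Maybe A} {w : Asg A} {c : A} {t : Asg A} → t ≗ₐ extend m w c → t ≈ᶠ w
  ≗extend⇒≈ᶠ t≗ {z} fz = trans (t≗ z) (extend-fresh fz)

  extend-cong : {m : Maybe A} {w w' : Asg A} {c : A} → w ≗ₐ w' → extend m w c ≗ₐ extend m w' c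
  extend-cong w≗w' = ≗-extend extend-y extend-u extend-u' extend-v (λ {z} fz → trans (extend-fresh fz) (w≗w' z))

  upd-≈ᶠ : {s s' : Asg A} (x : Var) (e : A) → s ≈ᶠ s' → upd s x e ≈ᶠ upd s' x e
  upd-≈ᶠ {s} {s'} x e s≈s' {z} fz with z ≟ x
  ... | yes refl = trans (upd-same s x e) (sym (upd-same s' x e))
  ... | no z≢x = trans (upd-other s x e z≢x) (trans (s≈s' fz) (sym (upd-other s' x e z≢x)))

  upd-extend : {m : Maybe A} {w s : Asg A} {c e : A} {x : Var} → Fresh x →
    s ≗ₐ extend m w c → upd s x e ≗ₐ extend m (upd w x e) c
  upd-extend {s = s} {e = e} {x} fx s≗ = ≗-extend
    (trans (upd-other s x e (y≢ fx)) (trans (s≗ y) extend-y))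
    (trans (upd-other s x e (u≢ fx)) (trans (s≗ u) extend-u))
    (trans (upd-other s x e (u'≢ fx)) (trans (s≗ u') extend-u'))
    (trans (upd-other s x e (v≢ fx)) (trans (s≗ v) extend-v))
    (upd-≈ᶠ x e (≗extend⇒≈ᶠ s≗))

  upd-v-extend : {m : Maybe A} {w s : Asg A} {c e : A} →
    s ≗ₐ extend m w c → upd s v e ≗ₐ extend (just e) w c
  upd-v-extend {s = s} {e = e} s≗ = ≗-extend
    (trans (upd-other s v e y≢v) (trans (s≗ y) extend-y))
    (trans (upd-other s v e (≢-sym v≢u)) (trans (s≗ u) extend-u))
    (trans (upd-other s v e (≢-sym v≢u')) (trans (s≗ u') extend-u'))
    (upd-same s v e)
    (λ {z} fz → trans (upd-other s v e (≢-sym (v≢ fz))) (trans (s≗ z) (extend-fresh fz)))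

  -- The team V of the theorem is Ext nothing unitTeam; inside a disjunction v holds its label a or b.
  Ext : Maybe A → Team A → Team A
  Ext m W t = Σ (Asg A) λ w → W w × Σ A λ c → S c × t ≗ₐ extend m w c

  extend∈Ext : {m : Maybe A} {W : Team A} {w : Asg A} {c : A} → W w → S c → Ext m W (extend m w c)
  extend∈Ext Ww Sc = _ , Ww , _ , Sc , λ _ → refl

  FreshLocal : (Asg A → Set) → Set
  FreshLocal P = ∀ {s t} → s ≈ᶠ t → P s → P t

  vmap-local : {k : ℕ} {xs : Vec Var k} (Q : Vec (Maybe A) k → Set) →
    FreshList (V.toList xs) → FreshLocal (λ s → Q (V.map s xs))
  vmap-local Q fxs s≈t = subst Q (vmap-≈ᶠ fxs s≈t)

  RelHolds-local : {R : Sym τ} {xs : Vec Var (ar τ R)} → FreshList (V.toList xs) → FreshLocal (RelHolds 𝔄 R xs)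
  RelHolds-local {R} = vmap-local (λ vs → Σ _ λ as → allJust vs ≡ just as × interp 𝔄 R as)

  NRelHolds-local : {R : Sym τ} {xs : Vec Var (ar τ R)} → FreshList (V.toList xs) → FreshLocal (NRelHolds 𝔄 R xs)
  NRelHolds-local {R} = vmap-local (λ vs → Σ _ λ as → allJust vs ≡ just as × ¬ interp 𝔄 R as)

  EqHolds-local : {x z : Var} → Fresh x → Fresh z → FreshLocal (EqHolds x z)
  EqHolds-local fx fz s≈t (k , sx , sz) = k , trans (sym (s≈t fx)) sx , trans (sym (s≈t fz)) sz

  NEqHolds-local : {x z : Var} → Fresh x → Fresh z → FreshLocal (NEqHolds x z)
  NEqHolds-local fx fz s≈t (k , k' , sx , sz , k≢k') =
    k , k' , trans (sym (s≈t fx)) sx , trans (sym (s≈t fz)) sz , k≢k'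

  Ext-pointwise : {m : Maybe A} {W : Team A} (P : Asg A → Set) → FreshLocal P →
    Lift (lsuc 0ℓ) (∀ w → W w → P w) ⇔ Lift (lsuc 0ℓ) (∀ t → Ext m W t → P t)
  Ext-pointwise P P-local = mk⇔
    (λ (lift h) → lift λ t (w , Ww , _ , _ , t≗) → P-local (λ fz → sym (≗extend⇒≈ᶠ t≗ fz)) (h w Ww))
    (λ (lift h) → lift λ w Ww → P-local extend-fresh (h _ (extend∈Ext Ww Sc₀)))

  Ext-dep : {m : Maybe A} {W : Team A} {xs : List Var} {x : Var} → FreshList xs → Fresh x →
    ⟦ E , W ⊨ dep xs x ⟧ ⇔ ⟦ 𝔄 , Ext m W ⊨ dep xs x ⟧
  Ext-dep fxs fx = mk⇔
    (λ (lift h) → lift λ t t' (w , Ww , _ , _ , t≗) (w' , Ww' , _ , _ , t'≗) same-xs →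
      let t≈w = ≗extend⇒≈ᶠ t≗ ; t'≈w' = ≗extend⇒≈ᶠ t'≗ in
      trans (t≈w fx) (trans (h w w' Ww Ww' (trans (sym (map-≈ᶠ fxs t≈w)) (trans same-xs (map-≈ᶠ fxs t'≈w'))))
                            (sym (t'≈w' fx))))
    (λ (lift h) → lift λ w w' Ww Ww' same-xs →
      trans (sym (extend-fresh fx))
        (trans (h _ _ (extend∈Ext Ww Sc₀) (extend∈Ext Ww' Sc₀)
                  (trans (map-≈ᶠ fxs extend-fresh) (trans same-xs (sym (map-≈ᶠ fxs extend-fresh)))))
               (extend-fresh fx)))

  Ext-inc-y : {m : Maybe A} {W : Team A} {x : Var} → Fresh x →
    ⟦ E , W ⊨ rel nothing (x ∷ []) ⟧ ⇔ ⟦ 𝔄 , Ext m W ⊨ inc (x ∷ []) (y ∷ []) ⟧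
  Ext-inc-y {m} fx = mk⇔
    (λ (lift h) → lift λ t (w , Ww , _ , _ , t≗) →
      let (as , wx , S-as) = h w Ww in
      extend m w (V.head as) , extend∈Ext Ww S-as ,
      cong (_∷ []) (trans (≗extend⇒≈ᶠ t≗ fx) (trans (allJust-single wx) (sym extend-y))))
    (λ (lift h) → lift λ w Ww →
      let (t' , (w' , _ , c' , Sc' , t'≗) , same) = h _ (extend∈Ext Ww Sc₀) in
      c' ∷ [] ,
      allJust-single⁺ (trans (sym (extend-fresh fx)) (trans (∷-injectiveˡ same) (trans (t'≗ y) extend-y))) ,
      Sc')

  Ext-exc-y : {m : Maybe A} {W : Team A} {x : Var} → Fresh x → (∀ {w} → W w → Σ A λ k → w x ≡ just k) →
    ⟦ E , W ⊨ nrel nothing (x ∷ []) ⟧ ⇔ ⟦ 𝔄 , Ext m W ⊨ exc (x ∷ []) (y ∷ []) ⟧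
  Ext-exc-y {m} {x = x} fx x-defined = mk⇔
    (λ (lift h) → lift λ t t' (w , Ww , _ , _ , t≗) (_ , _ , c' , Sc' , t'≗) same →
      let (as , wx , ¬S-as) = h w Ww in
      ¬S-as (subst S (just-injective (begin
        just c'       ≡⟨ sym (trans (t'≗ y) extend-y) ⟩
        t' y          ≡⟨ sym (∷-injectiveˡ same) ⟩
        t x           ≡⟨ ≗extend⇒≈ᶠ t≗ fx ⟩
        w x           ≡⟨ allJust-single wx ⟩
        just (V.head as) ∎)) Sc'))
    (λ (lift h) → lift λ w Ww →
      let (k , wx) = x-defined Ww in
      k ∷ [] , allJust-single⁺ wx , λ Sk →
        h _ _ (extend∈Ext Ww Sc₀) (extend∈Ext Ww Sk)
          (cong (_∷ []) (trans (extend-fresh fx) (trans wx (sym extend-y)))))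

  extend-yv-agree : {m : Maybe A} {w w' : Asg A} {c : A} {t : Asg A} {z : Var} →
    t ≗ₐ extend m w' c → z ≡ y ⊎ z ≡ v → extend m w c z ≡ t z
  extend-yv-agree t≗ (inj₁ refl) = trans extend-y (sym (trans (t≗ y) extend-y))
  extend-yv-agree t≗ (inj₂ refl) = trans extend-v (sym (trans (t≗ v) extend-v))

  Ext-ind-yv : {m : Maybe A} {W : Team A} {xs zs ws : List Var} →
    (∀ {z} → InL z xs → y ≢ z) → (∀ {z} → InL z zs → y ≢ z) →
    (∀ {z} → InL z ws → z ≡ y ⊎ z ≡ v) →
    ⟦ 𝔄 , Ext m W ⊨ ind xs zs ws ⟧
  Ext-ind-yv {m} {xs = xs} {zs} {ws} y∉xs y∉zs ws⊆yv =
    lift λ t₁ t₂ (w₁ , Ww₁ , _ , _ , t₁≗) (_ , _ , c₂ , Sc₂ , t₂≗) _ →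
      extend m w₁ c₂ , extend∈Ext Ww₁ Sc₂ ,
      map-cong-InL xs (λ i → trans (extend-≢y (y∉xs i)) (sym (t₁≗ _))) ,
      map-cong-InL zs (λ i → trans (extend-≢y (y∉zs i)) (sym (t₁≗ _))) ,
      map-cong-InL ws (λ i → extend-yv-agree t₂≗ (ws⊆yv i))

  updF-Ext⊆ : {m : Maybe A} {W : Team A} {x : Var} {F F' : Asg A → A → Set} → Fresh x →
    (∀ {s e} → Ext m W s → F s e →
      Σ (Asg A) λ w → W w × Σ A λ c → S c × s ≗ₐ extend m w c × F' w e) →
    updF (Ext m W) x F ⊆ᵀ Ext m (updF W x F')
  updF-Ext⊆ {x = x} fx decompose t (s , s∈ , e , Fse , t≗) =
    let (w , Ww , c , Sc , s≗ , F'we) = decompose s∈ Fse in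
    upd w x e , upd∈updF Ww F'we , c , Sc , λ z → trans (t≗ z) (upd-extend fx s≗ z)

  Ext-updF⊆ : {m : Maybe A} {W : Team A} {x : Var} {F F' : Asg A → A → Set} → Fresh x →
    (∀ {w e c} → W w → S c → F' w e → F (extend m w c) e) →
    Ext m (updF W x F') ⊆ᵀ updF (Ext m W) x F
  Ext-updF⊆ fx compose t (_ , (w , Ww , e , F'we , w'≗) , c , Sc , t≗) =
    updF-resp-≗ₐ (λ z → trans (t≗ z) (trans (extend-cong w'≗ z) (sym (upd-extend fx (λ _ → refl) z))))
      (upd∈updF (extend∈Ext Ww Sc) (compose Ww Sc F'we))

  Shaped : List Var → Team A → Set
  Shaped D U = ∀ {t} → U t →
    Σ (Maybe A) λ m → Σ (Asg A) λ w → Σ A λ c → HasDomain D w × t ≗ₐ extend m w c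

  -- The witness t₃ of the independence atom agrees with extend m w c' everywhere:
  -- at y by ws, on D by x and zs, at v through the dependence on x, elsewhere by the domains.
  y-swap : {U : Team A} {D zs ws : List Var} {x : Var} {m : Maybe A} {w t₂ : Asg A} {c c' : A} →
    Shaped D U → (∀ {z} → InL z D → z ≡ x ⊎ InL z zs) →
    ⟦ 𝔄 , U ⊨ dep (x ∷ []) v ⟧ → ⟦ 𝔄 , U ⊨ ind (x ∷ []) zs ws ⟧ → InL y ws →
    HasDomain D w → U (extend m w c) → U t₂ → t₂ y ≡ just c' →
    L.map (extend m w c) zs ≡ L.map t₂ zs →
    Σ (Asg A) λ t → U t × t ≗ₐ extend m w c'
  y-swap {D = D} {zs} {ws} {x} {w = w} shaped D⊆ (lift v-dep) (lift indep) y∈ws dom t₁∈ t₂∈ t₂y agree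
    with indep _ _ t₁∈ t₂∈ agree
  ... | t₃ , t₃∈ , same-x , same-zs , same-ws with shaped t₃∈
  ... | _ , w₃ , _ , dom₃ , t₃≗ =
    t₃ , t₃∈ , ≗-extend (trans (map-≡⇒InL ws same-ws y∈ws) t₂y)
                        (trans (t₃≗ u) extend-u) (trans (t₃≗ u') extend-u')
                        (trans (v-dep _ _ t₃∈ t₁∈ same-x) extend-v) t₃≈w
    where
    t₃≈w : t₃ ≈ᶠ w
    t₃≈w {z} fz with InL? z D
    ... | no z∉D = trans (≗extend⇒≈ᶠ t₃≗ fz) (trans (undefined dom₃ z∉D) (sym (undefined dom z∉D)))
    ... | yes z∈D with D⊆ z∈D
    ...   | inj₁ refl = trans (proj₁ (∷-injective same-x)) (extend-fresh fz)
    ...   | inj₂ z∈zs = trans (map-≡⇒InL {f = t₃} zs same-zs z∈zs) (extend-fresh fz)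

  all-case : {m : Maybe A} {ctx : List Var} {W : Team A} (x : Var) (φ : Fm (VY τ)) (ψ : Fm τ) →
    Fresh x → TeamDom ctx W →
    (∀ {W'} → TeamDom (x ∷ ctx) W' → ⟦ E , W' ⊨ φ ⟧ ⇔ ⟦ 𝔄 , Ext m W' ⊨ ψ ⟧) →
    ⟦ E , W ⊨ all x φ ⟧ ⇔ ⟦ 𝔄 , Ext m W ⊨ all x ψ ⟧
  all-case x φ ψ fx dom IH = ⇔-trans (IH (updF-TeamDom dom))
    (⊨-cong 𝔄 ψ (Ext-updF⊆ fx (λ _ _ _ → tt))
                (updF-Ext⊆ fx (λ (w , Ww , c , Sc , s≗) _ → w , Ww , c , Sc , s≗ , tt)))

  ex-translation : Var → List Var → List Var → Fm τ → Fm τ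
  ex-translation x ctx ws ψ = ex x (and (ind (x ∷ []) (remove x ctx) ws) ψ)

  extendChoice : Maybe A → Team A → (Asg A → A → Set) → Asg A → A → Set
  extendChoice m W F' s e = Σ (Asg A) λ w → W w × Σ A λ c → S c × s ≗ₐ extend m w c × F' w e

  -- F may choose differently for different y-values; ex-from uses the independence atom
  -- to show that taking all of these choices at once is harmless.
  restrictChoice : Maybe A → (Asg A → A → Set) → Asg A → A → Set
  restrictChoice m F w e = Σ (Asg A) λ s → Σ A λ c → S c × s ≗ₐ extend m w c × F s e

  ex-to : {m : Maybe A} {ctx : List Var} {W : Team A} (x : Var) (φ : Fm (VY τ)) (ψ : Fm τ) (ws : List Var) →
    (∀ {z} → InL z ws → z ≡ y ⊎ z ≡ v) → FreshList ctx → Fresh x → TeamDom ctx W →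
    (∀ {W'} → TeamDom (x ∷ ctx) W' → ⟦ E , W' ⊨ φ ⟧ ⇔ ⟦ 𝔄 , Ext m W' ⊨ ψ ⟧) →
    ⟦ E , W ⊨ ex x φ ⟧ → ⟦ 𝔄 , Ext m W ⊨ ex-translation x ctx ws ψ ⟧
  ex-to {m} {ctx} {W} x φ ψ ws ws⊆yv fctx fx dom IH (F' , total' , h) =
    extendChoice m W F' , total ,
    ⊨-resp 𝔄 (ind (x ∷ []) (remove x ctx) ws) Ext⊆U U⊆Ext
      (Ext-ind-yv (λ { (inj₁ refl) → y≢ fx ; (inj₂ ()) }) (λ i → y≢ (fctx (proj₁ (InL-remove⁻ i))))
                  ws⊆yv) ,
    ⊨-resp 𝔄 ψ Ext⊆U U⊆Ext (Equivalence.to (IH (updF-TeamDom dom)) h)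
    where
    total : ∀ s → Ext m W s → Σ A (extendChoice m W F' s)
    total s (w , Ww , c , Sc , s≗) = let (e , F'we) = total' w Ww in e , w , Ww , c , Sc , s≗ , F'we
    U⊆Ext : updF (Ext m W) x (extendChoice m W F') ⊆ᵀ Ext m (updF W x F')
    U⊆Ext = updF-Ext⊆ fx (λ _ choice → choice)
    Ext⊆U : Ext m (updF W x F') ⊆ᵀ updF (Ext m W) x (extendChoice m W F')
    Ext⊆U = Ext-updF⊆ fx (λ Ww Sc F'we → _ , Ww , _ , Sc , (λ _ → refl) , F'we)

  ex-from : {m : Maybe A} {ctx : List Var} {W : Team A} (x : Var) (φ : Fm (VY τ)) (ψ : Fm τ) (ws : List Var) →
    InL y ws → FreshList ctx → Fresh x → TeamDom ctx W →
    (∀ {W'} → TeamDom (x ∷ ctx) W' → ⟦ E , W' ⊨ φ ⟧ ⇔ ⟦ 𝔄 , Ext m W' ⊨ ψ ⟧) →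
    ⟦ 𝔄 , Ext m W ⊨ ex-translation x ctx ws ψ ⟧ → ⟦ E , W ⊨ ex x φ ⟧
  ex-from {m} {ctx} {W} x φ ψ ws y∈ws fctx fx dom IH (F , total , indep , hψ) =
    restrictChoice m F , total' , Equivalence.from (IH (updF-TeamDom dom)) (⊨-resp 𝔄 ψ U⊆Ext Ext⊆U hψ)
    where
    U : Team A
    U = updF (Ext m W) x F
    total' : ∀ w → W w → Σ A (restrictChoice m F w)
    total' w Ww = let (e , Fe) = total _ (extend∈Ext Ww Sc₀) in e , _ , c₀ , Sc₀ , (λ _ → refl) , Fe
    U⊆Ext : U ⊆ᵀ Ext m (updF W x (restrictChoice m F))
    U⊆Ext = updF-Ext⊆ fx (λ {s} (w , Ww , c , Sc , s≗) Fse → w , Ww , c , Sc , s≗ , s , c , Sc , s≗ , Fse)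
    shaped : Shaped (x ∷ ctx) U
    shaped (s , (w , Ww , c , _ , s≗) , e , _ , t≗) =
      m , upd w x e , c , HasDomain-upd x e (dom Ww) , λ z → trans (t≗ z) (upd-extend fx s≗ z)
    v-constant : ∀ {t} → U t → t v ≡ m
    v-constant (s , (_ , _ , _ , _ , s≗) , e , _ , t≗) =
      trans (t≗ v) (trans (upd-other s x e (v≢ fx)) (trans (s≗ v) extend-v))
    Ext⊆U : Ext m (updF W x (restrictChoice m F)) ⊆ᵀ U
    Ext⊆U t (_ , (w , Ww , e , (s , c' , Sc' , s≗ , Fse) , w'≗) , c , Sc , t≗) =
      let (e₂ , Fe₂) = total _ (extend∈Ext Ww Sc)
          (t₃ , t₃∈ , t₃≗) = y-swap shaped InL-∷-remove
            (lift λ _ _ t∈ t'∈ _ → trans (v-constant t∈) (sym (v-constant t'∈))) indep y∈ws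
            (HasDomain-upd x e (dom Ww))
            (updF-resp-≗ₐ (λ z → sym (upd-extend fx s≗ z)) (upd∈updF (w , Ww , c' , Sc' , s≗) Fse))
            (upd∈updF (extend∈Ext Ww Sc) Fe₂)
            (trans (upd-other (extend m w c) x e₂ (y≢ fx)) extend-y)
            (map-cong-InL (remove x ctx) λ i →
              let (z∈ctx , z≢x) = InL-remove⁻ i ; fz = fctx z∈ctx in
              trans (extend-fresh fz) (trans (upd-other w x e z≢x)
                (sym (trans (upd-other (extend m w c) x e₂ z≢x) (extend-fresh fz)))))
      in updF-resp-≗ₐ (λ z → trans (t≗ z) (trans (extend-cong w'≗ z) (sym (t₃≗ z)))) t₃∈

  or-translation : List Var → Fm τ → Fm τ → Fm τ
  or-translation ctx ψ₁ ψ₂ =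
    ex v (and (ind (v ∷ []) ctx (y ∷ [])) (or (and ψ₁ (eq v u)) (and ψ₂ (eq v u'))))

  Ext-v≡ : {W : Team A} {uₖ : Var} {aₖ : A} → (∀ {m w c} → extend m w c uₖ ≡ just aₖ) →
    ⟦ 𝔄 , Ext (just aₖ) W ⊨ eq v uₖ ⟧
  Ext-v≡ {uₖ = uₖ} {aₖ} extend-uₖ =
    lift λ t (_ , _ , _ , _ , t≗) → aₖ , trans (t≗ v) extend-v , trans (t≗ uₖ) extend-uₖ

  v-label : {U : Team A} {uₖ : Var} {aₖ e : A} {w t : Asg A} {c : A} →
    (∀ {m w c} → extend m w c uₖ ≡ just aₖ) →
    ⟦ 𝔄 , U ⊨ eq v uₖ ⟧ → U t → t ≗ₐ extend (just e) w c → e ≡ aₖ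
  v-label {uₖ = uₖ} {aₖ} {e} {w} {t} {c} extend-uₖ (lift v≡uₖ) t∈ t≗ =
    let (k , tv , tuₖ) = v≡uₖ t t∈ in
    just-injective (begin
      just e                  ≡⟨ sym extend-v ⟩
      extend (just e) w c v   ≡⟨ sym (t≗ v) ⟩
      t v                     ≡⟨ tv ⟩
      just k                  ≡⟨ sym tuₖ ⟩
      t uₖ                    ≡⟨ t≗ uₖ ⟩
      extend (just e) w c uₖ  ≡⟨ extend-uₖ ⟩
      just aₖ                 ∎)

  or-to : {m : Maybe A} {ctx : List Var} {W : Team A} (φ₁ φ₂ : Fm (VY τ)) (ψ₁ ψ₂ : Fm τ) →
    FreshList ctx → TeamDom ctx W →
    (∀ {m' W'} → TeamDom ctx W' → ⟦ E , W' ⊨ φ₁ ⟧ ⇔ ⟦ 𝔄 , Ext m' W' ⊨ ψ₁ ⟧) →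
    (∀ {m' W'} → TeamDom ctx W' → ⟦ E , W' ⊨ φ₂ ⟧ ⇔ ⟦ 𝔄 , Ext m' W' ⊨ ψ₂ ⟧) →
    ⟦ E , W ⊨ or φ₁ φ₂ ⟧ → ⟦ 𝔄 , Ext m W ⊨ or-translation ctx ψ₁ ψ₂ ⟧
  or-to {m} {ctx} {W} φ₁ φ₂ ψ₁ ψ₂ fctx dom IH₁ IH₂ (W₀ , W₁ , W₀⊆ , W₁⊆ , cover , h₀ , h₁) =
    F , total , lift independent , Ext (just a) W₀ , Ext (just b) W₁ ,
    (λ t (w , w∈W₀ , c , Sc , t≗) → updF-resp-≗ₐ t≗ (labelled∈ Sc (inj₁ (w∈W₀ , refl)))) ,
    (λ t (w , w∈W₁ , c , Sc , t≗) → updF-resp-≗ₐ t≗ (labelled∈ Sc (inj₂ (w∈W₁ , refl)))) ,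
    split ,
    (Equivalence.to (IH₁ (dom ∘ W₀⊆ _)) h₀ , Ext-v≡ extend-u) ,
    (Equivalence.to (IH₂ (dom ∘ W₁⊆ _)) h₁ , Ext-v≡ extend-u')
    where
    Label : Asg A → A → Set
    Label w e = (W₀ w × e ≡ a) ⊎ (W₁ w × e ≡ b)
    F : Asg A → A → Set
    F = extendChoice m W Label
    U : Team A
    U = updF (Ext m W) v F
    total : ∀ s → Ext m W s → Σ A (F s)
    total s (w , Ww , c , Sc , s≗) with cover w Ww
    ... | inj₁ w∈W₀ = a , w , Ww , c , Sc , s≗ , inj₁ (w∈W₀ , refl)
    ... | inj₂ w∈W₁ = b , w , Ww , c , Sc , s≗ , inj₂ (w∈W₁ , refl)
    labelled-view : ∀ {t} → U t →
      Σ (Asg A) λ w → Σ A λ c → Σ A λ e → S c × Label w e × t ≗ₐ extend (just e) w c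
    labelled-view (_ , _ , e , (w , _ , c , Sc , s≗ , ℓ) , t≗) =
      w , c , e , Sc , ℓ , λ z → trans (t≗ z) (upd-v-extend s≗ z)
    labelled∈ : ∀ {w c e} → S c → Label w e → U (extend (just e) w c)
    labelled∈ Sc ℓ =
      let Ww = [ W₀⊆ _ ∘ proj₁ , W₁⊆ _ ∘ proj₁ ]′ ℓ in
      updF-resp-≗ₐ (λ z → sym (upd-v-extend (λ _ → refl) z))
        (upd∈updF (extend∈Ext Ww Sc) (_ , Ww , _ , Sc , (λ _ → refl) , ℓ))
    independent : ∀ t₁ t₂ → U t₁ → U t₂ → L.map t₁ ctx ≡ L.map t₂ ctx →
      Σ (Asg A) λ t → U t × L.map t (v ∷ []) ≡ L.map t₁ (v ∷ [])
        × L.map t ctx ≡ L.map t₁ ctx × L.map t (y ∷ []) ≡ L.map t₂ (y ∷ [])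
    independent t₁ t₂ t₁∈ t₂∈ _ =
      let (w₁ , _ , e₁ , _ , ℓ₁ , t₁≗) = labelled-view t₁∈
          (_ , c₂ , _ , Sc₂ , _ , t₂≗) = labelled-view t₂∈ in
      extend (just e₁) w₁ c₂ , labelled∈ Sc₂ ℓ₁ ,
      cong (_∷ []) (trans extend-v (sym (trans (t₁≗ v) extend-v))) ,
      map-cong-InL ctx (λ i → trans (extend-≢y (y≢ (fctx i))) (sym (t₁≗ _))) ,
      cong (_∷ []) (trans extend-y (sym (trans (t₂≗ y) extend-y)))
    split : ∀ t → U t → Ext (just a) W₀ t ⊎ Ext (just b) W₁ t
    split t t∈ with labelled-view t∈
    ... | w , c , _ , Sc , inj₁ (w∈W₀ , refl) , t≗ = inj₁ (w , w∈W₀ , c , Sc , t≗)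
    ... | w , c , _ , Sc , inj₂ (w∈W₁ , refl) , t≗ = inj₂ (w , w∈W₁ , c , Sc , t≗)

  or-from : {m : Maybe A} {ctx : List Var} {W : Team A} (φ₁ φ₂ : Fm (VY τ)) (ψ₁ ψ₂ : Fm τ) →
    FreshList ctx → TeamDom ctx W →
    (∀ {m' W'} → TeamDom ctx W' → ⟦ E , W' ⊨ φ₁ ⟧ ⇔ ⟦ 𝔄 , Ext m' W' ⊨ ψ₁ ⟧) →
    (∀ {m' W'} → TeamDom ctx W' → ⟦ E , W' ⊨ φ₂ ⟧ ⇔ ⟦ 𝔄 , Ext m' W' ⊨ ψ₂ ⟧) →
    ⟦ 𝔄 , Ext m W ⊨ or-translation ctx ψ₁ ψ₂ ⟧ → ⟦ E , W ⊨ or φ₁ φ₂ ⟧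
  or-from {m} {ctx} {W} φ₁ φ₂ ψ₁ ψ₂ fctx dom IH₁ IH₂
    (F , total , indep , U₀ , U₁ , U₀⊆ , U₁⊆ , cover , (g₀ , v≡u) , (g₁ , v≡u')) =
    Branch a , Branch b , (λ _ → proj₁) , (λ _ → proj₁) , W-cover ,
    Equivalence.from (IH₁ (dom ∘ proj₁))
      (⊨-resp 𝔄 ψ₁ (branch-⊆ extend-u U₀⊆ v≡u) (branch-⊇ extend-u' a≢b cover v≡u') g₀) ,
    Equivalence.from (IH₂ (dom ∘ proj₁))
      (⊨-resp 𝔄 ψ₂ (branch-⊆ extend-u' U₁⊆ v≡u')
                   (branch-⊇ extend-u (≢-sym a≢b) (λ t → ⊎-swap ∘ cover t) v≡u) g₁)
    where
    U : Team A
    U = updF (Ext m W) v F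
    Branch : A → Team A
    Branch e w = W w × Σ A λ c → S c × U (extend (just e) w c)
    view : ∀ {t} → U t → Σ (Asg A) λ w → W w × Σ A λ c → S c × Σ A λ e → t ≗ₐ extend (just e) w c
    view (_ , (w , Ww , c , Sc , s≗) , e , _ , t≗) = w , Ww , c , Sc , e , λ z → trans (t≗ z) (upd-v-extend s≗ z)
    shaped : Shaped ctx U
    shaped t∈ = let (w , Ww , c , _ , e , t≗) = view t∈ in just e , w , c , dom Ww , t≗
    y-free : ∀ {e w c c'} → W w → U (extend (just e) w c) → S c' → U (extend (just e) w c')
    y-free {w = w} {c' = c'} Ww t₁∈ Sc' =
      let (e₂ , Fe₂) = total _ (extend∈Ext Ww Sc')
          (t₃ , t₃∈ , t₃≗) = y-swap shaped inj₂ (lift λ _ _ _ _ same → proj₁ (∷-injective same)) indep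
            (inj₁ refl) (dom Ww) t₁∈ (upd∈updF (extend∈Ext Ww Sc') Fe₂)
            (trans (upd-other (extend m w c') v e₂ y≢v) extend-y)
            (map-≈ᶠ fctx λ fz → trans (extend-fresh fz)
              (sym (trans (upd-other (extend m w c') v e₂ (≢-sym (v≢ fz))) (extend-fresh fz))))
      in updF-resp-≗ₐ (λ z → sym (t₃≗ z)) t₃∈
    branch-⊆ : ∀ {Uₖ uₖ aₖ} → (∀ {m w c} → extend m w c uₖ ≡ just aₖ) → Uₖ ⊆ᵀ U →
      ⟦ 𝔄 , Uₖ ⊨ eq v uₖ ⟧ → Uₖ ⊆ᵀ Ext (just aₖ) (Branch aₖ)
    branch-⊆ extend-uₖ Uₖ⊆ v≡uₖ t t∈ with view (Uₖ⊆ t t∈)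
    ... | w , Ww , c , Sc , e , t≗ with v-label extend-uₖ v≡uₖ t∈ t≗
    ...   | refl = w , (Ww , c , Sc , updF-resp-≗ₐ (λ z → sym (t≗ z)) (Uₖ⊆ t t∈)) , c , Sc , t≗
    branch-⊇ : ∀ {Uₖ Uₗ uₗ aₖ aₗ} → (∀ {m w c} → extend m w c uₗ ≡ just aₗ) → aₖ ≢ aₗ →
      (∀ t → U t → Uₖ t ⊎ Uₗ t) → ⟦ 𝔄 , Uₗ ⊨ eq v uₗ ⟧ → Ext (just aₖ) (Branch aₖ) ⊆ᵀ Uₖ
    branch-⊇ extend-uₗ aₖ≢aₗ cover v≡uₗ t (w , (Ww , _ , _ , t₁∈) , c , Sc , t≗)
      with cover t (updF-resp-≗ₐ t≗ (y-free Ww t₁∈ Sc))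
    ... | inj₁ t∈Uₖ = t∈Uₖ
    ... | inj₂ t∈Uₗ = ⊥-elim (aₖ≢aₗ (v-label extend-uₗ v≡uₗ t∈Uₗ t≗))
    branch-of : ∀ {Uₖ uₖ aₖ w e} → (∀ {m w c} → extend m w c uₖ ≡ just aₖ) →
      ⟦ 𝔄 , Uₖ ⊨ eq v uₖ ⟧ →
      W w → F (extend m w c₀) e → Uₖ (upd (extend m w c₀) v e) → Branch aₖ w
    branch-of extend-uₖ v≡uₖ Ww Fe t∈ with v-label extend-uₖ v≡uₖ t∈ (upd-v-extend (λ _ → refl))
    ... | refl = Ww , c₀ , Sc₀ ,
      updF-resp-≗ₐ (λ z → sym (upd-v-extend (λ _ → refl) z)) (upd∈updF (extend∈Ext Ww Sc₀) Fe)
    W-cover : ∀ w → W w → Branch a w ⊎ Branch b w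
    W-cover w Ww =
      let (e , Fe) = total _ (extend∈Ext Ww Sc₀) in
      ⊎-map (branch-of extend-u v≡u Ww Fe) (branch-of extend-u' v≡u' Ww Fe)
            (cover _ (upd∈updF (extend∈Ext Ww Sc₀) Fe))

  translation-correct : (φ : Fm (VY τ)) (ctx : List Var) (d : Bool) (m : Maybe A) →
    IsDL φ → BoundIn ctx φ → NotOcc y φ → NotOcc v φ → NotOcc u φ → NotOcc u' φ →
    FreshList ctx → {W : Team A} → TeamDom ctx W →
    ⟦ E , W ⊨ φ ⟧ ⇔ ⟦ 𝔄 , Ext m W ⊨ T y v u u' ctx d φ ⟧
  translation-correct (rel (just R) xs) _ _ _ _ _ y∉ v∉ u∉ u'∉ _ _ =
    Ext-pointwise (RelHolds 𝔄 R xs) (RelHolds-local (freshList y∉ v∉ u∉ u'∉))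
  translation-correct (rel nothing (x ∷ [])) _ _ _ _ _ y∉ v∉ u∉ u'∉ _ _ =
    Ext-inc-y (freshList y∉ v∉ u∉ u'∉ (inj₁ refl))
  translation-correct (nrel (just R) xs) _ _ _ _ _ y∉ v∉ u∉ u'∉ _ _ =
    Ext-pointwise (NRelHolds 𝔄 R xs) (NRelHolds-local (freshList y∉ v∉ u∉ u'∉))
  translation-correct (nrel nothing (x ∷ [])) _ _ _ _ (x∈ctx , _) y∉ v∉ u∉ u'∉ _ dom =
    Ext-exc-y (freshList y∉ v∉ u∉ u'∉ (inj₁ refl)) (λ Ww → defined (dom Ww) x∈ctx)
  translation-correct (eq x z) _ _ _ _ _ (y≢x , y≢z) (v≢x , v≢z) (u≢x , u≢z) (u'≢x , u'≢z) _ _ =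
    Ext-pointwise (EqHolds x z) (EqHolds-local (fresh y≢x v≢x u≢x u'≢x) (fresh y≢z v≢z u≢z u'≢z))
  translation-correct (neq x z) _ _ _ _ _ (y≢x , y≢z) (v≢x , v≢z) (u≢x , u≢z) (u'≢x , u'≢z) _ _ =
    Ext-pointwise (NEqHolds x z) (NEqHolds-local (fresh y≢x v≢x u≢x u'≢x) (fresh y≢z v≢z u≢z u'≢z))
  translation-correct (dep xs x) _ _ _ _ _ (y∉ , y≢x) (v∉ , v≢x) (u∉ , u≢x) (u'∉ , u'≢x) _ _ =
    Ext-dep (freshList y∉ v∉ u∉ u'∉) (fresh y≢x v≢x u≢x u'≢x)
  translation-correct (and φ ψ) ctx d m (dl₁ , dl₂) (bd₁ , bd₂)
                      (y₁ , y₂) (v₁ , v₂) (u₁ , u₂) (u'₁ , u'₂) fctx dom =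
    translation-correct φ ctx d m dl₁ bd₁ y₁ v₁ u₁ u'₁ fctx dom
      ×-⇔ translation-correct ψ ctx d m dl₂ bd₂ y₂ v₂ u₂ u'₂ fctx dom
  translation-correct (or φ ψ) ctx d m (dl₁ , dl₂) (bd₁ , bd₂)
                      (y₁ , y₂) (v₁ , v₂) (u₁ , u₂) (u'₁ , u'₂) fctx dom =
    mk⇔ (or-to φ ψ ψ₁ ψ₂ fctx dom IH₁ IH₂) (or-from φ ψ ψ₁ ψ₂ fctx dom IH₁ IH₂)
    where
    ψ₁ = T y v u u' ctx true φ
    ψ₂ = T y v u u' ctx true ψ
    IH₁ = λ {m'} {W'} → translation-correct φ ctx true m' dl₁ bd₁ y₁ v₁ u₁ u'₁ fctx {W'}
    IH₂ = λ {m'} {W'} → translation-correct ψ ctx true m' dl₂ bd₂ y₂ v₂ u₂ u'₂ fctx {W'}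
  translation-correct (ex x φ) ctx true m dl bd (y≢x , y∉) (v≢x , v∉) (u≢x , u∉) (u'≢x , u'∉) fctx dom =
    mk⇔ (ex-to x φ (T y v u u' (x ∷ ctx) true φ) (y ∷ v ∷ [])
           (λ { (inj₁ z≡y) → inj₁ z≡y ; (inj₂ (inj₁ z≡v)) → inj₂ z≡v }) fctx fx dom IH)
        (ex-from x φ (T y v u u' (x ∷ ctx) true φ) (y ∷ v ∷ []) (inj₁ refl) fctx fx dom IH)
    where
    fx = fresh y≢x v≢x u≢x u'≢x
    IH = λ {W'} → translation-correct φ (x ∷ ctx) true m dl bd y∉ v∉ u∉ u'∉ (FreshList-∷ fx fctx) {W'}
  translation-correct (ex x φ) ctx false m dl bd (y≢x , y∉) (v≢x , v∉) (u≢x , u∉) (u'≢x , u'∉) fctx dom =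
    mk⇔ (ex-to x φ (T y v u u' (x ∷ ctx) false φ) (y ∷ []) (λ { (inj₁ z≡y) → inj₁ z≡y }) fctx fx dom IH)
        (ex-from x φ (T y v u u' (x ∷ ctx) false φ) (y ∷ []) (inj₁ refl) fctx fx dom IH)
    where
    fx = fresh y≢x v≢x u≢x u'≢x
    IH = λ {W'} → translation-correct φ (x ∷ ctx) false m dl bd y∉ v∉ u∉ u'∉ (FreshList-∷ fx fctx) {W'}
  translation-correct (all x φ) ctx d m dl bd (y≢x , y∉) (v≢x , v∉) (u≢x , u∉) (u'≢x , u'∉) fctx dom =
    all-case x φ (T y v u u' (x ∷ ctx) d φ) fx dom
      (translation-correct φ (x ∷ ctx) d m dl bd y∉ v∉ u∉ u'∉ (FreshList-∷ fx fctx))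
    where fx = fresh y≢x v≢x u≢x u'≢x

  Ext-unit⊆VTeam : Ext nothing unitTeam ⊆ᵀ VTeam S a b y u u'
  Ext-unit⊆VTeam t (w , w≗∅ , c , Sc , t≗) =
    (c , Sc , trans (t≗ y) extend-y) , trans (t≗ u) extend-u , trans (t≗ u') extend-u' , undefined-elsewhere
    where
    undefined-elsewhere : ∀ z → z ≢ y → z ≢ u → z ≢ u' → t z ≡ nothing
    undefined-elsewhere z z≢y z≢u z≢u' with v ≟ z
    ... | yes refl = trans (t≗ v) extend-v
    ... | no v≢z =
      trans (≗extend⇒≈ᶠ t≗ (fresh (≢-sym z≢y) v≢z (≢-sym z≢u) (≢-sym z≢u'))) (w≗∅ z)

  VTeam⊆Ext-unit : VTeam S a b y u u' ⊆ᵀ Ext nothing unitTeam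
  VTeam⊆Ext-unit t ((c , Sc , ty) , tu , tu' , undefined-elsewhere) =
    emptyAsg , (λ _ → refl) , c , Sc ,
    ≗-extend ty tu tu' (undefined-elsewhere v (≢-sym y≢v) v≢u v≢u')
      (λ {z} fz → undefined-elsewhere z (≢-sym (y≢ fz)) (≢-sym (u≢ fz)) (≢-sym (u'≢ fz)))

unitTeam-dom : {A : Set} → TeamDom [] (unitTeam {A})
unitTeam-dom w≗∅ = record { defined = λ () ; undefined = λ {z} _ → w≗∅ z }

mainTheorem2 : {τ : Vocab} (χ : Fm (VY τ)) → Sentence χ → IsDL χ →
    (y v u u' : Var) →
    y ≢ v → y ≢ u → y ≢ u' → v ≢ u → v ≢ u' → u ≢ u' →
    NotOcc y χ → NotOcc v χ → NotOcc u χ → NotOcc u' χ →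
    {A : Set} (𝔄 : Structure τ A) →
    Σ A (λ c → Σ A (λ d → c ≢ d)) →
    (S : A → Set) → Σ A S →
    (a b : A) → a ≢ b →
    (⟦ expand 𝔄 S , unitTeam ⊨ χ ⟧ ⇔ ⟦ 𝔄 , VTeam S a b y u u' ⊨ TY y v u u' χ ⟧)
mainTheorem2 χ sentence dl y v u u' y≢v y≢u y≢u' v≢u v≢u' u≢u' y∉χ v∉χ u∉χ u'∉χ
             𝔄 _ S (_ , Sc₀) a b a≢b =
  ⇔-trans (translation-correct χ [] false nothing dl sentence y∉χ v∉χ u∉χ u'∉χ (λ ()) unitTeam-dom)
          (⊨-cong 𝔄 (TY y v u u' χ) Ext-unit⊆VTeam VTeam⊆Ext-unit)
  where open Translation 𝔄 S Sc₀ a b a≢b y v u u' y≢v y≢u y≢u' v≢u v≢u' u≢u'
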